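{- Let $p$ be a prime and let $a_k = 2pk + (k^2 \bmod p)$ for $k=1,2,\ldots,p-1$. Let $B=(b_1,\ldots,b_{p-2})$ with $b_i = a_{i+1}-a_i$. Then distinct contiguous subsequences $(b_k,\ldots,b_l)$, $1\le k\le l\le p-2$, of $B$ have pairwise distinct sums $\sum_{i=k}^l b_i$.
   Context: $k^2 \bmod p$ denotes the least nonnegative residue of $k^2$ modulo $p$. -}

module Defs where

open import Data.Nat using (ℕ; zero; suc; _*_; _%_; NonZero)
open import Data.Integer using (ℤ; +_; _-_; _+_)

a : (p : ℕ) → .{{_ : NonZero p}} → ℕ → ℤ
a p k = + (2 * p * k Data.Nat.+ (k * k) % p)

b : (p : ℕ) → .{{_ : NonZero p}} → ℕ → ℤ
b p i = a p (suc i) - a p i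

-- Σ_{i=k}^{k+n} b_i  (n+1 terms starting at index k)
sumFrom : (p : ℕ) → .{{_ : NonZero p}} → ℕ → ℕ → ℤ
sumFrom p k zero = b p k
sumFrom p k (suc n) = b p k + sumFrom p (suc k) n

-- Σ_{i=k}^{l} b_i for k ≤ l (uses l ∸ k; only applied when k ≤ l)
blockSum : (p : ℕ) → .{{_ : NonZero p}} → ℕ → ℕ → ℤ
blockSum p k l = sumFrom p k (l Data.Nat.∸ k)

-- By telescoping, b_k + … + b_l = a_{l+1} − a_k, so equal sums over (k, l) and (k′, l′)
-- give a_L + a_{k′} = a_{L′} + a_k with L = l + 1, L′ = l′ + 1.  As a_n = 2pn + (n² mod p)
-- with residues below p, this splits into L + k′ = L′ + k and
-- L² + k′² ≡ L′² + k² (mod p).  If k = k′ the blocks coincide; otherwise, say k < k′,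
-- write k′ = k + d and L = k + m, so L′ = k + d + m, and the identity
-- (k+d+m)² + k² = (k+m)² + (k+d)² + 2dm gives p ∣ 2dm, impossible for an odd prime p
-- with 0 < d, m < p.
module Submission where

open import Defs
open import Data.Nat using (ℕ; _≤_; _∸_)
open import Data.Nat.Primality using (Prime; prime⇒nonZero; prime⇒nonTrivial; euclidsLemma)
open import Data.Product using (_×_; _,_; swap)
open import Relation.Binary.PropositionalEquality
  using (_≡_; _≢_; refl; sym; trans; cong; cong₂; subst; module ≡-Reasoning)
open import Relation.Nullary using (¬_)
open import Data.Nat.Base using (zero; suc; _+_; _*_; _%_; _/_; _<_; NonZero; s≤s; nonTrivial⇒n>1)
open import Data.Nat.Properties
open import Data.Nat.DivMod
open import Data.Nat.Divisibility using (_∣_; _∤_; divides; >⇒∤)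
open import Data.Nat.Tactic.RingSolver using (solve-∀)
import Data.Integer as ℤ
import Data.Integer.Properties as ℤ
import Data.Integer.Tactic.RingSolver as ℤ
open import Data.Sum using ([_,_])
open import Data.Empty using (⊥-elim)
open import Function using (_∘_)
open import Relation.Binary using (tri<; tri≈; tri>)

remainder-quotient-unique : ∀ c .{{_ : NonZero c}} {s t u v} → s < c → t < c →
  s + u * c ≡ t + v * c → s ≡ t × u ≡ v
remainder-quotient-unique c {s} {t} {u} {v} s<c t<c eq = s≡t , u≡v
  where
  open ≡-Reasoning
  s≡t : s ≡ t
  s≡t = begin
    s               ≡⟨ sym (m<n⇒m%n≡m s<c) ⟩
    s % c           ≡⟨ sym ([m+kn]%n≡m%n s u c) ⟩
    (s + u * c) % c ≡⟨ %-congˡ eq ⟩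
    (t + v * c) % c ≡⟨ [m+kn]%n≡m%n t v c ⟩
    t % c           ≡⟨ m<n⇒m%n≡m t<c ⟩
    t               ∎
  u≡v : u ≡ v
  u≡v = *-cancelʳ-≡ u v c (+-cancelˡ-≡ s _ _ (trans eq (cong (_+ v * c) (sym s≡t))))

[m+n]%d≡m%d⇒d∣n : ∀ m n d .{{_ : NonZero d}} → (m + n) % d ≡ m % d → d ∣ n
[m+n]%d≡m%d⇒d∣n m n d eq = divides (q′ ∸ q) (begin
    n                                    ≡⟨ m+n∸m≡n m n ⟨
    (m + n) ∸ m                          ≡⟨ cong₂ _∸_ (m≡m%n+[m/n]*n (m + n) d) (m≡m%n+[m/n]*n m d) ⟩
    ((m + n) % d + q′ * d) ∸ (m % d + q * d) ≡⟨ cong (λ r → (r + q′ * d) ∸ (m % d + q * d)) eq ⟩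
    (m % d + q′ * d) ∸ (m % d + q * d)   ≡⟨ [m+n]∸[m+o]≡n∸o (m % d) _ _ ⟩
    q′ * d ∸ q * d                       ≡⟨ *-distribʳ-∸ d q′ q ⟨
    (q′ ∸ q) * d                         ∎)
  where
  open ≡-Reasoning
  q q′ : ℕ
  q = m / d
  q′ = (m + n) / d

prime∤2*m*n : ∀ {p m n} → Prime p → 2 < p → 0 < m → m < p → 0 < n → n < p → p ∤ 2 * m * n
prime∤2*m*n {_} {suc m} {suc n} pr 2<p _ m<p _ n<p p∣2mn =
  [ [ >⇒∤ 2<p , >⇒∤ m<p ] ∘ euclidsLemma 2 (suc m) pr , >⇒∤ n<p ]
    (euclidsLemma (2 * suc m) (suc n) pr p∣2mn)

m≤n∸2⇒1+m<n : ∀ {m n} → 2 ≤ n → m ≤ n ∸ 2 → suc m < n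
m≤n∸2⇒1+m<n {m} {n} 2≤n m≤n∸2 = subst (_≤ n) (+-comm m 2) (m≤o∸n⇒m+n≤o m 2≤n m≤n∸2)

module _ (p : ℕ) .{{_ : NonZero p}} where

  sqMod : ℕ → ℕ
  sqMod n = n * n % p

  sumFrom-telescopes : ∀ k n → sumFrom p k n ℤ.+ a p k ≡ a p (suc (n + k))
  sumFrom-telescopes k zero = cancel (a p (suc k)) (a p k)
    where
    cancel : ∀ x y → (x ℤ.- y) ℤ.+ y ≡ x
    cancel = ℤ.solve-∀
  sumFrom-telescopes k (suc n) = begin
    (b p k ℤ.+ sumFrom p (suc k) n) ℤ.+ a p k ≡⟨ shift (a p (suc k)) (a p k) (sumFrom p (suc k) n) ⟩
    sumFrom p (suc k) n ℤ.+ a p (suc k)       ≡⟨ sumFrom-telescopes (suc k) n ⟩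
    a p (suc (n + suc k))                     ≡⟨ cong (a p ∘ suc) (+-suc n k) ⟩
    a p (suc (suc n + k))                     ∎
    where
    open ≡-Reasoning
    shift : ∀ x y s → ((x ℤ.- y) ℤ.+ s) ℤ.+ y ≡ s ℤ.+ x
    shift = ℤ.solve-∀

  blockSum-telescopes : ∀ {k l} → k ≤ l → blockSum p k l ℤ.+ a p k ≡ a p (suc l)
  blockSum-telescopes {k} {l} k≤l =
    trans (sumFrom-telescopes k (l ∸ k)) (cong (a p ∘ suc) (m∸n+n≡m k≤l))

  blockSum≡⇒a-balanced : ∀ {k l k′ l′} → k ≤ l → k′ ≤ l′ → blockSum p k l ≡ blockSum p k′ l′ →
    a p (suc l) ℤ.+ a p k′ ≡ a p (suc l′) ℤ.+ a p k
  blockSum≡⇒a-balanced {k} {l} {k′} {l′} k≤l k′≤l′ sums≡ = begin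
    a p (suc l) ℤ.+ a p k′                     ≡⟨ cong (ℤ._+ a p k′) (blockSum-telescopes k≤l) ⟨
    (blockSum p k l ℤ.+ a p k) ℤ.+ a p k′      ≡⟨ exchange (blockSum p k l) (a p k) (a p k′) ⟩
    (blockSum p k l ℤ.+ a p k′) ℤ.+ a p k      ≡⟨ cong (λ s → (s ℤ.+ a p k′) ℤ.+ a p k) sums≡ ⟩
    (blockSum p k′ l′ ℤ.+ a p k′) ℤ.+ a p k    ≡⟨ cong (ℤ._+ a p k) (blockSum-telescopes k′≤l′) ⟩
    a p (suc l′) ℤ.+ a p k                     ∎
    where
    open ≡-Reasoning
    exchange : ∀ s x y → (s ℤ.+ x) ℤ.+ y ≡ (s ℤ.+ y) ℤ.+ x
    exchange = ℤ.solve-∀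

  sqMod+sqMod<2p : ∀ m n → sqMod m + sqMod n < 2 * p
  sqMod+sqMod<2p m n = subst (sqMod m + sqMod n <_) (cong (p +_) (sym (+-identityʳ p)))
    (+-mono-< (m%n<n (m * m) p) (m%n<n (n * n) p))

  a-balanced⇒balanced : ∀ {L K L′ K′} → a p L ℤ.+ a p K ≡ a p L′ ℤ.+ a p K′ →
    L + K ≡ L′ + K′ × sqMod L + sqMod K ≡ sqMod L′ + sqMod K′
  a-balanced⇒balanced {L} {K} {L′} {K′} eq = swap (remainder-quotient-unique (2 * p) {{m*n≢0 2 p}}
    (sqMod+sqMod<2p L K) (sqMod+sqMod<2p L′ K′) (begin
      sqMod L + sqMod K + (L + K) * (2 * p)           ≡⟨ regroup (2 * p) L K (sqMod L) (sqMod K) ⟨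
      2 * p * L + sqMod L + (2 * p * K + sqMod K)     ≡⟨ ℤ.+-injective eq ⟩
      2 * p * L′ + sqMod L′ + (2 * p * K′ + sqMod K′) ≡⟨ regroup (2 * p) L′ K′ (sqMod L′) (sqMod K′) ⟩
      sqMod L′ + sqMod K′ + (L′ + K′) * (2 * p)       ∎))
    where
    open ≡-Reasoning
    regroup : ∀ c L K u v → c * L + u + (c * K + v) ≡ u + v + (L + K) * c
    regroup = solve-∀

  balanced-squares⇒∣ : ∀ k d m → sqMod (k + m) + sqMod (k + d) ≡ sqMod (k + d + m) + sqMod k →
    p ∣ 2 * d * m
  balanced-squares⇒∣ k d m eq = [m+n]%d≡m%d⇒d∣n X (2 * d * m) p (begin
    (X + 2 * d * m) % p                 ≡⟨ %-congˡ (expand k d m) ⟨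
    (Y * Y + k * k) % p                 ≡⟨ %-distribˡ-+ (Y * Y) (k * k) p ⟩
    (sqMod Y + sqMod k) % p             ≡⟨ %-congˡ eq ⟨
    (sqMod (k + m) + sqMod (k + d)) % p ≡⟨ %-distribˡ-+ ((k + m) * (k + m)) _ p ⟨
    X % p                               ∎)
    where
    open ≡-Reasoning
    X Y : ℕ
    X = (k + m) * (k + m) + (k + d) * (k + d)
    Y = k + d + m
    expand : ∀ k d m → (k + d + m) * (k + d + m) + k * k ≡
      (k + m) * (k + m) + (k + d) * (k + d) + 2 * d * m
    expand = solve-∀

  module _ (pr : Prime p) (2<p : 2 < p) where

    shifted-squares-unbalanced : ∀ k d m → 0 < d → 0 < m → k + d + m < p →
      sqMod (k + m) + sqMod (k + d) ≢ sqMod (k + d + m) + sqMod k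
    shifted-squares-unbalanced k d m 0<d 0<m k+d+m<p =
      prime∤2*m*n pr 2<p 0<d (≤-<-trans d≤k+d+m k+d+m<p) 0<m (≤-<-trans (m≤n+m m (k + d)) k+d+m<p)
      ∘ balanced-squares⇒∣ k d m
      where
      d≤k+d+m : d ≤ k + d + m
      d≤k+d+m = ≤-trans (m≤n+m d k) (m≤m+n (k + d) m)

    balanced-residues-impossible : ∀ {K K′ L L′} → K < K′ → K < L → L′ < p →
      L + K′ ≡ L′ + K → sqMod L + sqMod K′ ≢ sqMod L′ + sqMod K
    balanced-residues-impossible {K} {K′} {L} {L′} K<K′ K<L L′<p indices≡ residues≡ =
      shifted-squares-unbalanced K d m (m<n⇒0<n∸m K<K′) (m<n⇒0<n∸m K<L)
        (subst (_< p) (sym K+d+m≡L′) L′<p) (begin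
          sqMod (K + m) + sqMod (K + d) ≡⟨ cong₂ (λ x y → sqMod x + sqMod y) K+m≡L K+d≡K′ ⟩
          sqMod L + sqMod K′            ≡⟨ residues≡ ⟩
          sqMod L′ + sqMod K            ≡⟨ cong (λ x → sqMod x + sqMod K) K+d+m≡L′ ⟨
          sqMod (K + d + m) + sqMod K   ∎)
      where
      open ≡-Reasoning
      d m : ℕ
      d = K′ ∸ K
      m = L ∸ K
      K+d≡K′ : K + d ≡ K′
      K+d≡K′ = m+[n∸m]≡n (<⇒≤ K<K′)
      K+m≡L : K + m ≡ L
      K+m≡L = m+[n∸m]≡n (<⇒≤ K<L)
      K+d+m≡L′ : K + d + m ≡ L′
      K+d+m≡L′ = +-cancelʳ-≡ K _ _ (begin
        K + d + m + K       ≡⟨ regroup K d m ⟩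
        (K + m) + (K + d)   ≡⟨ cong₂ _+_ K+m≡L K+d≡K′ ⟩
        L + K′              ≡⟨ indices≡ ⟩
        L′ + K              ∎)
        where
        regroup : ∀ K d m → K + d + m + K ≡ (K + m) + (K + d)
        regroup = solve-∀

    blockSum-injective : ∀ {k l k′ l′} → k ≤ l → suc l < p → k′ ≤ l′ → suc l′ < p →
      blockSum p k l ≡ blockSum p k′ l′ → (k , l) ≡ (k′ , l′)
    blockSum-injective {k} {l} {k′} {l′} k≤l 1+l<p k′≤l′ 1+l′<p sums≡
      with indices≡ , residues≡ ← a-balanced⇒balanced (blockSum≡⇒a-balanced k≤l k′≤l′ sums≡)
      with <-cmp k k′
    ... | tri< k<k′ _ _ = ⊥-elim (balanced-residues-impossible
            k<k′ (s≤s k≤l) 1+l′<p indices≡ residues≡)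
    ... | tri> _ _ k′<k = ⊥-elim (balanced-residues-impossible
            k′<k (s≤s k′≤l′) 1+l<p (sym indices≡) (sym residues≡))
    ... | tri≈ _ refl _ = cong (k ,_) (suc-injective (+-cancelʳ-≡ k _ _ indices≡))

proposition2 : (p : ℕ) → (pr : Prime p) → (k l k′ l′ : ℕ) →
    1 ≤ k → k ≤ l → l ≤ p ∸ 2 →
    1 ≤ k′ → k′ ≤ l′ → l′ ≤ p ∸ 2 →
    ¬ ((k , l) ≡ (k′ , l′)) →
    blockSum p {{prime⇒nonZero pr}} k l ≢ blockSum p {{prime⇒nonZero pr}} k′ l′
proposition2 p pr k l k′ l′ 1≤k k≤l l≤p∸2 _ k′≤l′ l′≤p∸2 kl≢k′l′ =
  kl≢k′l′ ∘ blockSum-injective p pr 2<p k≤l 1+l<p k′≤l′ (m≤n∸2⇒1+m<n 2≤p l′≤p∸2)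
  where
  instance
    _ : NonZero p
    _ = prime⇒nonZero pr
  2≤p : 2 ≤ p
  2≤p = nonTrivial⇒n>1 p {{prime⇒nonTrivial pr}}
  1+l<p : suc l < p
  1+l<p = m≤n∸2⇒1+m<n 2≤p l≤p∸2
  2<p : 2 < p
  2<p = ≤-<-trans (s≤s (≤-trans 1≤k k≤l)) 1+l<p
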